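{- Let $m\geq 3$ be an integer. For a positive integer $n$, let $\Lambda_m(n)$ denote the undirected Cayley graph of the cyclic group $\mathbf{Z}_n$ whose connection set is $\{\pm r_j : j=0,1,\ldots,m-1\}$, where $r_j$ is the integer nearest to $n^{j/m}$ (so $r_j=n^{j/m}$ when this is an integer; in particular $r_0=1$). Then for all sufficiently large $n$ the graph $\Lambda_m(n)$ is $2m$-regular (and vertex transitive), and its diameter is asymptotically of order $n^{1/m}=|V(\Lambda_m(n))|^{1/m}$, i.e. there are constants $0<c_1\le c_2$ (depending only on $m$) with $c_1 n^{1/m}\le \operatorname{diam}\Lambda_m(n)\le c_2 n^{1/m}$ for all sufficiently large $n$. In particular, for $m=3$ this gives a family of $6$-regular Cayley graphs with diameter asymptotically of order $|V|^{1/3}$.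
   Context: A Cayley graph of $\mathbf{Z}_n$ with symmetric connection set $S\subseteq \mathbf{Z}_n\setminus\{0\}$ has vertex set $\mathbf{Z}_n$, with $x$ adjacent to $y$ iff $y-x\in S$. -}

module Defs where

open import Data.Nat using (ℕ; zero; suc; _+_; _*_; _∸_; _^_; _≤_; _<_; NonZero)
open import Data.Nat.Properties using (_≟_)
open import Data.Nat.DivMod using (_%_)
open import Data.Fin using (Fin; toℕ)
open import Data.List using (List; []; _∷_; concatMap; filter; length; allFin)
open import Data.List.Membership.Propositional using (_∈_)
open import Data.List.Membership.DecPropositional _≟_ using (_∈?_)
open import Data.Product using (_×_; ∃-syntax; Σ)
open import Function.Bundles using (_↔_; _⇔_; Inverse)
open import Relation.Nullary using (¬_)
open import Relation.Binary.PropositionalEquality using (_≡_)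
open import Relation.Unary using (Decidable)

-- r is the integer nearest to n^(j/m), written without reals:
--   r - 1/2 ≤ n^(j/m) < r + 1/2   ⇔   (2r-1)^m ≤ 2^m n^j < (2r+1)^m
-- (ties r ± 1/2 = n^(j/m) are impossible, since 2^m n^j is even and (2r±1)^m odd).
IsNearest : (m n j r : ℕ) → Set
IsNearest m n j r = ((2 * r ∸ 1) ^ m ≤ 2 ^ m * n ^ j) × (2 ^ m * n ^ j < (2 * r + 1) ^ m)

module Λ (m n : ℕ) {{_ : NonZero n}} (r : Fin m → ℕ) where

  S : List ℕ
  S = concatMap (λ j → (r j % n) ∷ ((n ∸ (r j % n)) % n) ∷ []) (allFin m)

  -- x ~ y  iff  y - x ∈ S  (in Z_n)
  Adj : Fin n → Fin n → Set
  Adj x y = ((n ∸ toℕ x + toℕ y) % n) ∈ S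

  Adj? : (x : Fin n) → Decidable (Adj x)
  Adj? x y = ((n ∸ toℕ x + toℕ y) % n) ∈? S

  degree : Fin n → ℕ
  degree x = length (filter (Adj? x) (allFin n))

  Regular2m : Set
  Regular2m = (¬ (0 ∈ S)) × (∀ x → degree x ≡ 2 * m)

  VertexTransitive : Set
  VertexTransitive = ∀ a b → Σ (Fin n ↔ Fin n) λ σ → ((Inverse.to σ a ≡ b)
    × (∀ x y → Adj x y ⇔ Adj (Inverse.to σ x) (Inverse.to σ y)))

  data Walk : Fin n → Fin n → ℕ → Set where
    here : ∀ {x} → Walk x x 0
    step : ∀ {x y z ℓ} → Adj x y → Walk y z ℓ → Walk x z (suc ℓ)

  HasDiameter : ℕ → Set
  HasDiameter d = (∀ x y → ∃[ ℓ ] ((ℓ ≤ d) × Walk x y ℓ))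
                × (∃[ x ] ∃[ y ] (∀ ℓ → Walk x y ℓ → d ≤ ℓ))

module Submission where

-- Write r_m = n. The nearest-integer condition gives r_j^m ≤ 2^m n^j < (3 r_j)^m, hence
-- r_0 = 1, r_0 < … < r_{m-1} < n/2 and r_{k+1}^m ≤ 3^m n r_k^m. The first two facts make the
-- 2m residues ±r_j distinct and nonzero, so the graph is 2m-regular; translations are
-- automorphisms of every Cayley graph of Z_n. Upper bound: expanding y − x greedily in the
-- mixed radix r_{m-1}, …, r_0 gives a walk whose digits q satisfy q^m ≤ 3^m n, so that
-- d^m ≤ m^m 3^m n. Lower bound: a walk of length ≤ d from x ends at x + Σ c_j r_j with
-- |c_j| ≤ d, so (2d+1)^m coefficient vectors cover Z_n and n ≤ (2d+1)^m ≤ 3^m d^m.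

open import Data.Nat
  using (ℕ; zero; suc; _+_; _*_; _∸_; _^_; _≤_; _<_; _⊔_; pred; NonZero; z≤n; s≤s; z<s; s≤s⁻¹;
         >-nonZero; >-nonZero⁻¹)
open import Data.Nat.Properties
open import Data.Nat.DivMod
  using (_%_; _/_; m≡m%n+[m/n]*n; m/n*n≤m; m%n<n; m%n≤n; m%n%n≡m%n; %-distribˡ-+; [m+n]%n≡m%n;
         [m+kn]%n≡m%n; m<n⇒m%n≡m)
open import Data.Fin using (Fin; zero; suc; toℕ; fromℕ<; funToFin; finToFun)
open import Data.Fin.Properties
  using (toℕ<n; toℕ-fromℕ<; toℕ-injective; any?; all?; ¬∀⟶∃¬; finToFun-funToFin; injective⇒≤)
  renaming (_≟_ to _≟ᶠ_)
open import Data.Product using (_×_; _,_; proj₁; proj₂; ∃-syntax)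
open import Algebra.Properties.Semiring.Sum +-*-semiring
  using (sum; sum-cong-≗; sum-replicate-zero; ∑-distrib-+; *-distribˡ-sum)
open import Data.Sum using (_⊎_; inj₁; inj₂)
open import Relation.Nullary.Negation using (contradiction)
open import Data.List using (List; []; _∷_; _++_; map; filter; length; allFin)
open import Data.List.Properties using (length-map; length-++; length-tabulate)
open import Data.List.Membership.Propositional using (_∈_; lose)
open import Data.List.Membership.Propositional.Properties
  using (∈-map⁺; ∈-map⁻; ∈-++⁺ˡ; ∈-++⁺ʳ; ∈-++⁻; ∈-concatMap⁺; ∈-concatMap⁻; ∈-allFin;
         ∈-filter⁺; ∈-filter⁻)
open import Data.List.Membership.Propositional.Properties.WithK using (unique∧set⇒bag)
open import Data.List.Relation.Unary.Any using (here; there; satisfied)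
open import Data.List.Relation.Unary.Unique.Propositional using (Unique)
import Data.List.Relation.Unary.Unique.Propositional.Properties as Unique
open import Data.List.Relation.Binary.BagAndSetEquality using (∼bag⇒↭)
open import Data.List.Relation.Binary.Permutation.Propositional.Properties using (↭-length)
open import Function.Bundles using (_⇔_; mk⇔; mk↔ₛ′)
open import Relation.Nullary using (¬_; Dec; yes; no)
open import Relation.Nullary.Decidable using (map′; _×-dec_)
open import Relation.Unary as U using ()
open import Relation.Binary.Definitions using (tri<; tri≈; tri>)
open import Relation.Binary.PropositionalEquality
open import Data.Nat.Tactic.RingSolver using (solve-∀)

open import Defs

^-distribʳ-* : ∀ a b k → (a * b) ^ k ≡ a ^ k * b ^ k
^-distribʳ-* a b zero    = refl
^-distribʳ-* a b (suc k) =
  trans (cong (a * b *_) (^-distribʳ-* a b k)) ([m*n]*[o*p]≡[m*o]*[n*p] a b (a ^ k) (b ^ k))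

0^k≡0 : ∀ k .{{_ : NonZero k}} → 0 ^ k ≡ 0
0^k≡0 (suc _) = refl

a≤a^k : ∀ a k .{{_ : NonZero k}} → a ≤ a ^ k
a≤a^k zero    k       = z≤n
a≤a^k (suc a) (suc k) =
  subst (_≤ suc a ^ suc k) (*-identityʳ (suc a)) (*-monoʳ-≤ (suc a) (m^n>0 (suc a) k))

⊔-^-≤ : ∀ {a b c} k → a ^ k ≤ c → b ^ k ≤ c → (a ⊔ b) ^ k ≤ c
⊔-^-≤ {a} {b} k a^k≤c b^k≤c with ⊔-sel a b
... | inj₁ a⊔b≡a = subst (λ t → t ^ k ≤ _) (sym a⊔b≡a) a^k≤c
... | inj₂ a⊔b≡b = subst (λ t → t ^ k ≤ _) (sym a⊔b≡b) b^k≤c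

r≤2r∸1 : ∀ r → 0 < r → r ≤ 2 * r ∸ 1
r≤2r∸1 (suc r) _ =
  subst (suc r ≤_) (sym (cong (_∸ 1) (+-suc (suc r) (r + 0)))) (m≤m+n (suc r) (r + 0))

2r+1≤3r : ∀ r → 0 < r → 2 * r + 1 ≤ 3 * r
2r+1≤3r r 0<r = subst (_≤ 3 * r) (+-comm 1 (2 * r)) (+-monoˡ-≤ (2 * r) 0<r)

m≤2ℓ+c⇒m+n≤2[1+ℓ]+c : ∀ {a b ℓ c} → a ≤ 2 * ℓ + c → b ≤ 2 → a + b ≤ 2 * suc ℓ + c
m≤2ℓ+c⇒m+n≤2[1+ℓ]+c {a} {b} {ℓ} {c} a≤ b≤2 = ≤-trans (+-mono-≤ a≤ b≤2) (≤-reflexive (rearrange ℓ c))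
  where
  rearrange : ∀ ℓ c → 2 * ℓ + c + 2 ≡ 2 * suc ℓ + c
  rearrange = solve-∀

+-<-halves : ∀ a b {n} → 2 * a < n → 2 * b < n → a + b < n
+-<-halves a b {n} 2a<n 2b<n = *-cancelˡ-< 2 (a + b) n (begin-strict
  2 * (a + b)     ≡⟨ *-distribˡ-+ 2 a b ⟩
  2 * a + 2 * b   <⟨ +-mono-< 2a<n 2b<n ⟩
  n + n           ≡⟨ cong (n +_) (+-identityʳ n) ⟨
  2 * n           ∎)
  where open ≤-Reasoning

threshold : ∀ {p} {P : ℕ → Set p} → U.Decidable P → ∀ {D} → P D →
            ∃[ d ] (P d × (∀ {e} → suc e ≡ d → ¬ P e))
threshold P? {zero} PD = 0 , PD , λ ()
threshold P? {suc D} PD with P? D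
... | yes PD′ = threshold P? PD′
... | no ¬PD′ = suc D , PD , λ { refl → ¬PD′ }

δ : ∀ {k} → Fin k → Fin k → ℕ
δ zero    zero    = 1
δ zero    (suc _) = 0
δ (suc _) zero    = 0
δ (suc j) (suc i) = δ j i

δ≤1 : ∀ {k} (j i : Fin k) → δ j i ≤ 1
δ≤1 zero    zero    = ≤-refl
δ≤1 zero    (suc _) = z≤n
δ≤1 (suc _) zero    = z≤n
δ≤1 (suc j) (suc i) = δ≤1 j i

∑-δ : ∀ {k} (j : Fin k) (h : Fin k → ℕ) → sum (λ i → δ j i * h i) ≡ h j
∑-δ {suc k} zero    h =
  trans (cong (h zero + 0 +_) (sum-replicate-zero k)) (trans (+-identityʳ _) (+-identityʳ (h zero)))
∑-δ {suc k} (suc j) h = ∑-δ j (λ i → h (suc i))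

funToFin-injective : ∀ {k l} {f g : Fin k → Fin l} → funToFin f ≡ funToFin g → ∀ i → f i ≡ g i
funToFin-injective {f = f} {g} eq i =
  trans (sym (finToFun-funToFin f i)) (trans (cong (λ c → finToFun c i) eq) (finToFun-funToFin g i))

ladder : ∀ {m} → (Fin m → ℕ) → ℕ → ℕ → ℕ
ladder {zero}  r top _       = top
ladder {suc m} r top zero    = r zero
ladder {suc m} r top (suc k) = ladder (λ j → r (suc j)) top k

ladder-toℕ : ∀ {m} (r : Fin m → ℕ) top j → ladder r top (toℕ j) ≡ r j
ladder-toℕ r top zero    = refl
ladder-toℕ r top (suc j) = ladder-toℕ (λ j → r (suc j)) top j

ladder-top : ∀ {m} (r : Fin m → ℕ) top → ladder r top m ≡ top
ladder-top {zero}  r top = refl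
ladder-top {suc m} r top = ladder-top (λ j → r (suc j)) top

ladder-< : ∀ {m k} (r : Fin m → ℕ) top (k<m : k < m) → ladder r top k ≡ r (fromℕ< k<m)
ladder-< r top k<m = trans (cong (ladder r top) (sym (toℕ-fromℕ< k<m))) (ladder-toℕ r top (fromℕ< k<m))

module Translation (n : ℕ) {{_ : NonZero n}} where

  infixl 6 _⊕_

  _⊕_ : Fin n → ℕ → Fin n
  x ⊕ a = fromℕ< (m%n<n (toℕ x + a) n)

  -- the residue of y - x, exactly as it occurs in Λ.Adj
  diff : Fin n → Fin n → ℕ
  diff x y = (n ∸ toℕ x + toℕ y) % n

  diff<n : ∀ x y → diff x y < n
  diff<n x y = m%n<n (n ∸ toℕ x + toℕ y) n

  toℕ-⊕ : ∀ x a → toℕ (x ⊕ a) ≡ (toℕ x + a) % n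
  toℕ-⊕ x a = toℕ-fromℕ< (m%n<n (toℕ x + a) n)

  ≡-mod⇒⊕-≡ : ∀ x a y b → (toℕ x + a) % n ≡ (toℕ y + b) % n → x ⊕ a ≡ y ⊕ b
  ≡-mod⇒⊕-≡ x a y b eq = toℕ-injective (trans (toℕ-⊕ x a) (trans eq (sym (toℕ-⊕ y b))))

  %-absorbʳ : ∀ a b → (a + b % n) % n ≡ (a + b) % n
  %-absorbʳ a b = begin
    (a + b % n) % n           ≡⟨ %-distribˡ-+ a (b % n) n ⟩
    (a % n + b % n % n) % n   ≡⟨ cong (λ t → (a % n + t) % n) (m%n%n≡m%n b n) ⟩
    (a % n + b % n) % n       ≡⟨ %-distribˡ-+ a b n ⟨
    (a + b) % n               ∎
    where open ≡-Reasoning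

  ⊕-% : ∀ x a → x ⊕ a % n ≡ x ⊕ a
  ⊕-% x a = ≡-mod⇒⊕-≡ x (a % n) x a (%-absorbʳ (toℕ x) a)

  ⊕-assoc : ∀ x a b → x ⊕ a ⊕ b ≡ x ⊕ (a + b)
  ⊕-assoc x a b = ≡-mod⇒⊕-≡ (x ⊕ a) b x (a + b) (begin
    (toℕ (x ⊕ a) + b) % n     ≡⟨ cong (λ t → (t + b) % n) (toℕ-⊕ x a) ⟩
    ((toℕ x + a) % n + b) % n ≡⟨ cong (_% n) (+-comm ((toℕ x + a) % n) b) ⟩
    (b + (toℕ x + a) % n) % n ≡⟨ %-absorbʳ b (toℕ x + a) ⟩
    (b + (toℕ x + a)) % n     ≡⟨ cong (_% n) (trans (+-comm b (toℕ x + a)) (+-assoc (toℕ x) a b)) ⟩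
    (toℕ x + (a + b)) % n     ∎)
    where open ≡-Reasoning

  ⊕-+-comm : ∀ x a b → x ⊕ (a + b) ≡ x ⊕ b ⊕ a
  ⊕-+-comm x a b = trans (cong (x ⊕_) (+-comm a b)) (sym (⊕-assoc x b a))

  ⊕-identityʳ : ∀ x → x ⊕ 0 ≡ x
  ⊕-identityʳ x = toℕ-injective (begin
    toℕ (x ⊕ 0)       ≡⟨ toℕ-⊕ x 0 ⟩
    (toℕ x + 0) % n   ≡⟨ cong (_% n) (+-identityʳ (toℕ x)) ⟩
    toℕ x % n         ≡⟨ m<n⇒m%n≡m (toℕ<n x) ⟩
    toℕ x             ∎)
    where open ≡-Reasoning

  ⊕-*n : ∀ x k → x ⊕ k * n ≡ x
  ⊕-*n x k = trans (≡-mod⇒⊕-≡ x (k * n) x 0 [x+kn]%n≡[x+0]%n) (⊕-identityʳ x)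
    where
    [x+kn]%n≡[x+0]%n = trans ([m+kn]%n≡m%n (toℕ x) k n) (cong (_% n) (sym (+-identityʳ (toℕ x))))

  ⊕-n : ∀ x → x ⊕ n ≡ x
  ⊕-n x = trans (cong (x ⊕_) (sym (*-identityˡ n))) (⊕-*n x 1)

  -- c * pred n represents -c
  private
    c+c*pred-n : ∀ c → c + c * pred n ≡ c * n
    c+c*pred-n c = trans (sym (*-suc c (pred n))) (cong (c *_) (suc-pred n))

  ⊕-⊖ : ∀ x c → x ⊕ c ⊕ c * pred n ≡ x
  ⊕-⊖ x c = begin
    x ⊕ c ⊕ c * pred n    ≡⟨ ⊕-assoc x c (c * pred n) ⟩
    x ⊕ (c + c * pred n)  ≡⟨ cong (x ⊕_) (c+c*pred-n c) ⟩
    x ⊕ c * n             ≡⟨ ⊕-*n x c ⟩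
    x                     ∎
    where open ≡-Reasoning

  ⊖-⊕ : ∀ x c → x ⊕ c * pred n ⊕ c ≡ x
  ⊖-⊕ x c = begin
    x ⊕ c * pred n ⊕ c    ≡⟨ ⊕-assoc x (c * pred n) c ⟩
    x ⊕ (c * pred n + c)  ≡⟨ cong (x ⊕_) (trans (+-comm (c * pred n) c) (c+c*pred-n c)) ⟩
    x ⊕ c * n             ≡⟨ ⊕-*n x c ⟩
    x                     ∎
    where open ≡-Reasoning

  ⊕-cancelʳ : ∀ {x y} c → x ⊕ c ≡ y ⊕ c → x ≡ y
  ⊕-cancelʳ {x} {y} c eq = begin
    x                     ≡⟨ ⊕-⊖ x c ⟨
    x ⊕ c ⊕ c * pred n    ≡⟨ cong (_⊕ c * pred n) eq ⟩
    y ⊕ c ⊕ c * pred n    ≡⟨ ⊕-⊖ y c ⟩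
    y                     ∎
    where open ≡-Reasoning

  ⊕-cancelˡ : ∀ x {a b} → a < n → b < n → x ⊕ a ≡ x ⊕ b → a ≡ b
  ⊕-cancelˡ x {a} {b} a<n b<n eq = begin
    a                          ≡⟨ toℕ-fromℕ< a<n ⟨
    toℕ (fromℕ< a<n)           ≡⟨ cong toℕ (⊕-cancelʳ (toℕ x) (trans (sym (swap a<n)) (trans eq (swap b<n)))) ⟩
    toℕ (fromℕ< b<n)           ≡⟨ toℕ-fromℕ< b<n ⟩
    b                          ∎
    where
    open ≡-Reasoning
    swap : ∀ {c} (c<n : c < n) → x ⊕ c ≡ fromℕ< c<n ⊕ toℕ x
    swap {c} c<n = ≡-mod⇒⊕-≡ x c (fromℕ< c<n) (toℕ x)
                     (cong (_% n) (trans (+-comm (toℕ x) c) (cong (_+ toℕ x) (sym (toℕ-fromℕ< c<n)))))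

  ⊕-diff : ∀ x y → x ⊕ diff x y ≡ y
  ⊕-diff x y = toℕ-injective (begin
    toℕ (x ⊕ diff x y)                      ≡⟨ toℕ-⊕ x (diff x y) ⟩
    (toℕ x + (n ∸ toℕ x + toℕ y) % n) % n   ≡⟨ %-absorbʳ (toℕ x) (n ∸ toℕ x + toℕ y) ⟩
    (toℕ x + (n ∸ toℕ x + toℕ y)) % n       ≡⟨ cong (_% n) (+-assoc (toℕ x) (n ∸ toℕ x) (toℕ y)) ⟨
    (toℕ x + (n ∸ toℕ x) + toℕ y) % n       ≡⟨ cong (λ t → (t + toℕ y) % n) (m+[n∸m]≡n (<⇒≤ (toℕ<n x))) ⟩
    (n + toℕ y) % n                         ≡⟨ cong (_% n) (+-comm n (toℕ y)) ⟩
    (toℕ y + n) % n                         ≡⟨ [m+n]%n≡m%n (toℕ y) n ⟩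
    toℕ y % n                               ≡⟨ m<n⇒m%n≡m (toℕ<n y) ⟩
    toℕ y                                   ∎)
    where open ≡-Reasoning

  diff-⊕ : ∀ x {t} → t < n → diff x (x ⊕ t) ≡ t
  diff-⊕ x {t} t<n = ⊕-cancelˡ x (diff<n x (x ⊕ t)) t<n (⊕-diff x (x ⊕ t))

  diff-injective : ∀ x {y y′} → diff x y ≡ diff x y′ → y ≡ y′
  diff-injective x {y} {y′} eq = trans (sym (⊕-diff x y)) (trans (cong (x ⊕_) eq) (⊕-diff x y′))

  diff-⊕-⊕ : ∀ x y c → diff (x ⊕ c) (y ⊕ c) ≡ diff x y
  diff-⊕-⊕ x y c = ⊕-cancelˡ (x ⊕ c) (diff<n (x ⊕ c) (y ⊕ c)) (diff<n x y) (begin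
    x ⊕ c ⊕ diff (x ⊕ c) (y ⊕ c)   ≡⟨ ⊕-diff (x ⊕ c) (y ⊕ c) ⟩
    y ⊕ c                          ≡⟨ cong (_⊕ c) (⊕-diff x y) ⟨
    x ⊕ diff x y ⊕ c               ≡⟨ ⊕-+-comm x c (diff x y) ⟨
    x ⊕ (c + diff x y)             ≡⟨ ⊕-assoc x c (diff x y) ⟨
    x ⊕ c ⊕ diff x y               ∎)
    where open ≡-Reasoning

module CayleyGraph (m n : ℕ) {{_ : NonZero n}} (r : Fin m → ℕ) where

  open Λ m n r
  open Translation n

  r⁺ r⁻ : Fin m → ℕ
  r⁺ j = r j % n
  r⁻ j = (n ∸ r j % n) % n

  pair : Fin m → List ℕ
  pair j = r⁺ j ∷ r⁻ j ∷ []

  S± : List ℕ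
  S± = map r⁺ (allFin m) ++ map r⁻ (allFin m)

  length-S± : length S± ≡ 2 * m
  length-S± = begin
    length S±
      ≡⟨ length-++ (map r⁺ (allFin m)) ⟩
    length (map r⁺ (allFin m)) + length (map r⁻ (allFin m))
      ≡⟨ cong₂ _+_ (length-map r⁺ (allFin m)) (length-map r⁻ (allFin m)) ⟩
    length (allFin m) + length (allFin m)
      ≡⟨ cong₂ _+_ length-allFin (trans length-allFin (sym (+-identityʳ m))) ⟩
    2 * m
      ∎
    where
    open ≡-Reasoning
    length-allFin = length-tabulate {n = m} (λ j → j)

  ∈S⁻ : ∀ {t} → t ∈ S → ∃[ j ] (t ≡ r⁺ j ⊎ t ≡ r⁻ j)
  ∈S⁻ t∈S with satisfied (∈-concatMap⁻ pair {xs = allFin m} t∈S)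
  ... | j , here t≡r⁺ = j , inj₁ t≡r⁺
  ... | j , there (here t≡r⁻) = j , inj₂ t≡r⁻

  ∈S⁺ : ∀ {t} j → t ≡ r⁺ j ⊎ t ≡ r⁻ j → t ∈ S
  ∈S⁺ j (inj₁ refl) = ∈-concatMap⁺ pair (lose (∈-allFin j) (here refl))
  ∈S⁺ j (inj₂ refl) = ∈-concatMap⁺ pair (lose (∈-allFin j) (there (here refl)))

  ∈S⇒∈S± : ∀ {t} → t ∈ S → t ∈ S±
  ∈S⇒∈S± t∈S with ∈S⁻ t∈S
  ... | j , inj₁ refl = ∈-++⁺ˡ (∈-map⁺ r⁺ (∈-allFin j))
  ... | j , inj₂ refl = ∈-++⁺ʳ (map r⁺ (allFin m)) (∈-map⁺ r⁻ (∈-allFin j))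

  ∈S±⇒∈S : ∀ {t} → t ∈ S± → t ∈ S
  ∈S±⇒∈S t∈S± with ∈-++⁻ (map r⁺ (allFin m)) t∈S±
  ... | inj₁ t∈r⁺ = let j , _ , t≡ = ∈-map⁻ r⁺ t∈r⁺ in ∈S⁺ j (inj₁ t≡)
  ... | inj₂ t∈r⁻ = let j , _ , t≡ = ∈-map⁻ r⁻ t∈r⁻ in ∈S⁺ j (inj₂ t≡)

  ∈S⇒<n : ∀ {t} → t ∈ S → t < n
  ∈S⇒<n t∈S with ∈S⁻ t∈S
  ... | j , inj₁ refl = m%n<n (r j) n
  ... | j , inj₂ refl = m%n<n (n ∸ r j % n) n

  Adj-⊕ : ∀ j x → Adj x (x ⊕ r j)
  Adj-⊕ j x = subst (_∈ S) (sym diff≡r⁺) (∈S⁺ j (inj₁ refl))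
    where
    diff≡r⁺ : diff x (x ⊕ r j) ≡ r⁺ j
    diff≡r⁺ = trans (cong (diff x) (sym (⊕-% x (r j)))) (diff-⊕ x (m%n<n (r j) n))

  Adj⇒± : ∀ {x y} → Adj x y → ∃[ j ] (y ≡ x ⊕ r j ⊎ x ≡ y ⊕ r j)
  Adj⇒± {x} {y} xy with ∈S⁻ xy
  ... | j , inj₁ diff≡r⁺ = j , inj₁ (begin
    y               ≡⟨ ⊕-diff x y ⟨
    x ⊕ diff x y    ≡⟨ cong (x ⊕_) diff≡r⁺ ⟩
    x ⊕ r j % n     ≡⟨ ⊕-% x (r j) ⟩
    x ⊕ r j         ∎)
    where open ≡-Reasoning
  ... | j , inj₂ diff≡r⁻ = j , inj₂ (begin
    x                            ≡⟨ ⊕-n x ⟨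
    x ⊕ n                        ≡⟨ cong (x ⊕_) (m∸n+n≡m (m%n≤n (r j) n)) ⟨
    x ⊕ (n ∸ s + s)              ≡⟨ ⊕-assoc x (n ∸ s) s ⟨
    x ⊕ (n ∸ s) ⊕ s              ≡⟨ cong (_⊕ s) (trans (sym (⊕-% x (n ∸ s))) (cong (x ⊕_) (sym diff≡r⁻))) ⟩
    x ⊕ diff x y ⊕ s             ≡⟨ cong (_⊕ s) (⊕-diff x y) ⟩
    y ⊕ r j % n                  ≡⟨ ⊕-% y (r j) ⟩
    y ⊕ r j                      ∎)
    where
    open ≡-Reasoning
    s = r j % n

  vertexTransitive : VertexTransitive
  vertexTransitive a b = σ , ⊕-diff a b , λ x y → mk⇔ (subst (_∈ S) (sym (diff-⊕-⊕ x y c)))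
                                                       (subst (_∈ S) (diff-⊕-⊕ x y c))
    where
    c = diff a b
    σ = mk↔ₛ′ (_⊕ c) (_⊕ c * pred n) (λ y → ⊖-⊕ y c) (λ y → ⊕-⊖ y c)

  -- y ↦ diff x y maps the neighbourhood of x bijectively onto the connection set
  degree≡2m : Unique S± → ∀ x → degree x ≡ 2 * m
  degree≡2m unique-S± x = begin
    length N                   ≡⟨ length-map (diff x) N ⟨
    length (map (diff x) N)    ≡⟨ ↭-length (∼bag⇒↭ (unique∧set⇒bag unique-diff[N] unique-S± N∼S±)) ⟩
    length S±                  ≡⟨ length-S± ⟩
    2 * m                      ∎
    where
    open ≡-Reasoning
    N = filter (Adj? x) (allFin n)
    unique-diff[N] : Unique (map (diff x) N)
    unique-diff[N] = Unique.map⁺ (diff-injective x) (Unique.filter⁺ (Adj? x) (Unique.allFin⁺ n))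
    N∼S± : ∀ {t} → t ∈ map (diff x) N ⇔ t ∈ S±
    N∼S± = mk⇔ to from
      where
      to : ∀ {t} → t ∈ map (diff x) N → t ∈ S±
      to t∈ = let y , y∈N , t≡ = ∈-map⁻ (diff x) t∈ in
              ∈S⇒∈S± (subst (_∈ S) (sym t≡) (proj₂ (∈-filter⁻ (Adj? x) {xs = allFin n} y∈N)))
      from : ∀ {t} → t ∈ S± → t ∈ map (diff x) N
      from t∈S± = subst (_∈ map (diff x) N) (diff-⊕ x t<n)
                    (∈-map⁺ (diff x) (∈-filter⁺ (Adj? x) (∈-allFin (x ⊕ _)) xy))
        where
        t∈S = ∈S±⇒∈S t∈S±
        t<n = ∈S⇒<n t∈S
        xy = subst (_∈ S) (sym (diff-⊕ x t<n)) t∈S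

module Separated (m n : ℕ) {{_ : NonZero n}} (r : Fin m → ℕ)
                 (r-pos : ∀ j → 0 < r j)
                 (r+r<n : ∀ i j → r i + r j < n)
                 (r-injective : ∀ {i j} → r i ≡ r j → i ≡ j) where

  open Λ m n r
  open CayleyGraph m n r

  r<n : ∀ j → r j < n
  r<n j = ≤-<-trans (m≤m+n (r j) (r j)) (r+r<n j j)

  r⁺≡r : ∀ j → r⁺ j ≡ r j
  r⁺≡r j = m<n⇒m%n≡m (r<n j)

  r⁻≡n∸r : ∀ j → r⁻ j ≡ n ∸ r j
  r⁻≡n∸r j = trans (cong (λ t → (n ∸ t) % n) (r⁺≡r j)) (m<n⇒m%n≡m (∸-monoʳ-< (r-pos j) (<⇒≤ (r<n j))))

  r⁺≢r⁻ : ∀ i j → r⁺ i ≢ r⁻ j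
  r⁺≢r⁻ i j eq = <⇒≢ (r+r<n i j) (begin
    r i + r j         ≡⟨ cong (_+ r j) (trans (sym (r⁺≡r i)) (trans eq (r⁻≡n∸r j))) ⟩
    n ∸ r j + r j     ≡⟨ m∸n+n≡m (<⇒≤ (r<n j)) ⟩
    n                 ∎)
    where open ≡-Reasoning

  unique-S± : Unique S±
  unique-S± = Unique.++⁺ (Unique.map⁺ r⁺-injective (Unique.allFin⁺ m))
                         (Unique.map⁺ r⁻-injective (Unique.allFin⁺ m)) disjoint
    where
    r⁺-injective : ∀ {i j} → r⁺ i ≡ r⁺ j → i ≡ j
    r⁺-injective {i} {j} eq = r-injective (trans (sym (r⁺≡r i)) (trans eq (r⁺≡r j)))
    r⁻-injective : ∀ {i j} → r⁻ i ≡ r⁻ j → i ≡ j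
    r⁻-injective {i} {j} eq = r-injective (∸-cancelˡ-≡ (<⇒≤ (r<n i)) (<⇒≤ (r<n j))
                                (trans (sym (r⁻≡n∸r i)) (trans eq (r⁻≡n∸r j))))
    disjoint : ∀ {t} → ¬ (t ∈ map r⁺ (allFin m) × t ∈ map r⁻ (allFin m))
    disjoint (t∈r⁺ , t∈r⁻) with ∈-map⁻ r⁺ t∈r⁺ | ∈-map⁻ r⁻ t∈r⁻
    ... | i , _ , refl | j , _ , eq = r⁺≢r⁻ i j eq

  0∉S : ¬ (0 ∈ S)
  0∉S 0∈S with ∈S⁻ 0∈S
  ... | j , inj₁ 0≡r⁺ = <⇒≢ (r-pos j) (trans 0≡r⁺ (r⁺≡r j))
  ... | j , inj₂ 0≡r⁻ = <⇒≢ (m<n⇒0<n∸m (r<n j)) (trans 0≡r⁻ (r⁻≡n∸r j))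

  regular : Regular2m
  regular = 0∉S , degree≡2m unique-S±

module Walks (m n : ℕ) {{_ : NonZero n}} (r : Fin m → ℕ) where

  open Λ m n r
  open Translation n

  infixr 5 _++ʷ_

  _++ʷ_ : ∀ {x y z k ℓ} → Walk x y k → Walk y z ℓ → Walk x z (k + ℓ)
  here        ++ʷ w′ = w′
  step xy w   ++ʷ w′ = step xy (w ++ʷ w′)

  walk-⊕-* : ∀ c → (∀ x → Adj x (x ⊕ c)) → ∀ q x → Walk x (x ⊕ q * c) q
  walk-⊕-* c edge zero    x = subst (λ y → Walk x y 0) (sym (⊕-identityʳ x)) here
  walk-⊕-* c edge (suc q) x =
    step (edge x) (subst (λ y → Walk (x ⊕ c) y q) (⊕-assoc x c (q * c)) (walk-⊕-* c edge q (x ⊕ c)))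

  Within : ℕ → Fin n → Fin n → Set
  Within d x y = ∃[ ℓ ] (ℓ ≤ d × Walk x y ℓ)

  Connected : ℕ → Set
  Connected d = ∀ x y → Within d x y

  walk? : ∀ ℓ x y → Dec (Walk x y ℓ)
  walk? zero x y with x ≟ᶠ y
  ... | yes refl = yes here
  ... | no x≢y   = no λ { here → x≢y refl }
  walk? (suc ℓ) x y with any? (λ z → Adj? x z ×-dec walk? ℓ z y)
  ... | yes (z , xz , w) = yes (step xz w)
  ... | no ¬w            = no λ { (step xz w) → ¬w (_ , xz , w) }

  within? : ∀ d x y → Dec (Within d x y)
  within? d x y = map′ (λ (ℓ , ℓ<1+d , w) → ℓ , s≤s⁻¹ ℓ<1+d , w)
                       (λ (ℓ , ℓ≤d , w) → ℓ , s≤s ℓ≤d , w)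
                       (anyUpTo? (λ ℓ → walk? ℓ x y) (suc d))

  connected? : U.Decidable Connected
  connected? d = all? λ x → all? (within? d x)

  far-pair : ∀ d → (∀ {e} → suc e ≡ d → ¬ Connected e) →
             ∃[ x ] ∃[ y ] (∀ ℓ → Walk x y ℓ → d ≤ ℓ)
  far-pair zero    _ = x₀ , x₀ , λ _ _ → z≤n
    where x₀ = fromℕ< (>-nonZero⁻¹ n)
  far-pair (suc e) ¬conn with ¬∀⟶∃¬ n _ (λ x → all? (within? e x)) (¬conn refl)
  ... | x , ¬x with ¬∀⟶∃¬ n _ (within? e x) ¬x
  ...   | y , ¬xy = x , y , λ ℓ w → ≰⇒> λ ℓ≤e → ¬xy (ℓ , ℓ≤e , w)

  diameter-exists : ∀ {D} → Connected D → ∃[ d ] HasDiameter d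
  diameter-exists conn with threshold connected? conn
  ... | d , conn-d , below = d , conn-d , far-pair d below

module Ball (m n : ℕ) {{_ : NonZero n}} (r : Fin m → ℕ) where

  open Λ m n r
  open Translation n
  open CayleyGraph m n r using (Adj⇒±)
  open Walks m n r using (Within)

  Σr : ℕ
  Σr = sum r

  weighted : (Fin m → ℕ) → ℕ
  weighted e = sum (λ i → e i * r i)

  weighted-cong : ∀ {e f} → (∀ i → e i ≡ f i) → weighted e ≡ weighted f
  weighted-cong e≗f = sum-cong-≗ (λ i → cong (_* r _) (e≗f i))

  weighted-+ : ∀ e f → weighted (λ i → e i + f i) ≡ weighted e + weighted f
  weighted-+ e f = trans (sum-cong-≗ (λ i → *-distribʳ-+ (r i) (e i) (f i)))
                         (∑-distrib-+ (λ i → e i * r i) (λ i → f i * r i))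

  weighted-const : ∀ c → weighted (λ _ → c) ≡ c * Σr
  weighted-const c = sym (*-distribˡ-sum c r)

  forward backward : (Fin m → ℕ) → Fin m → Fin m → ℕ
  forward  e j i = e i + suc (δ j i)
  backward e j i = e i + (1 ∸ δ j i)

  weighted-forward : ∀ e j → weighted (forward e j) ≡ weighted e + (Σr + r j)
  weighted-forward e j = begin
    weighted (forward e j)                      ≡⟨ weighted-+ e (λ i → suc (δ j i)) ⟩
    weighted e + sum (λ i → r i + δ j i * r i)  ≡⟨ cong (weighted e +_) (∑-distrib-+ r (λ i → δ j i * r i)) ⟩
    weighted e + (Σr + weighted (δ j))          ≡⟨ cong (λ t → weighted e + (Σr + t)) (∑-δ j r) ⟩
    weighted e + (Σr + r j)                     ∎
    where open ≡-Reasoning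

  weighted-backward : ∀ e j → weighted (backward e j) + r j ≡ weighted e + Σr
  weighted-backward e j = begin
    weighted (backward e j) + r j                 ≡⟨ cong₂ _+_ (weighted-+ e 1∸δ) (sym (∑-δ j r)) ⟩
    weighted e + weighted 1∸δ + weighted (δ j)    ≡⟨ +-assoc (weighted e) (weighted 1∸δ) (weighted (δ j)) ⟩
    weighted e + (weighted 1∸δ + weighted (δ j))  ≡⟨ cong (weighted e +_) 1∸δ+δ ⟩
    weighted e + Σr                               ∎
    where
    open ≡-Reasoning
    1∸δ = λ i → 1 ∸ δ j i
    1∸δ+δ : weighted 1∸δ + weighted (δ j) ≡ Σr
    1∸δ+δ = begin
      weighted 1∸δ + weighted (δ j)        ≡⟨ weighted-+ 1∸δ (δ j) ⟨
      weighted (λ i → 1 ∸ δ j i + δ j i)   ≡⟨ weighted-cong (λ i → m∸n+n≡m (δ≤1 j i)) ⟩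
      weighted (λ _ → 1)                   ≡⟨ weighted-const 1 ⟩
      1 * Σr                               ≡⟨ *-identityˡ Σr ⟩
      Σr                                   ∎

  -- Each step adds Σr on the left and Σr ± r j on the right, so that all coefficients stay in ℕ.
  displacement : ∀ c {x z ℓ} → Walk x z ℓ →
                 ∃[ e ] ((∀ i → e i ≤ 2 * ℓ + c) × z ⊕ (ℓ + c) * Σr ≡ x ⊕ weighted e)
  displacement c {x} here = (λ _ → c) , (λ _ → ≤-refl) , cong (x ⊕_) (sym (weighted-const c))
  displacement c {x} {z} {suc ℓ} (step {y = y} xy w) with displacement c w | Adj⇒± xy
  ... | e , e≤ , z≡y | j , inj₁ y≡x⊕r =
    forward e j ,
    (λ i → m≤2ℓ+c⇒m+n≤2[1+ℓ]+c {ℓ = ℓ} {c = c} (e≤ i) (s≤s (δ≤1 j i))) , (begin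
      z ⊕ (suc ℓ + c) * Σr            ≡⟨ ⊕-+-comm z Σr ((ℓ + c) * Σr) ⟩
      z ⊕ (ℓ + c) * Σr ⊕ Σr           ≡⟨ cong (_⊕ Σr) (trans z≡y (cong (_⊕ weighted e) y≡x⊕r)) ⟩
      x ⊕ r j ⊕ weighted e ⊕ Σr       ≡⟨ trans (⊕-assoc (x ⊕ r j) (weighted e) Σr) (⊕-assoc x (r j) _) ⟩
      x ⊕ (r j + (weighted e + Σr))   ≡⟨ cong (x ⊕_) (trans (+-comm (r j) _) (+-assoc (weighted e) Σr (r j))) ⟩
      x ⊕ (weighted e + (Σr + r j))   ≡⟨ cong (x ⊕_) (weighted-forward e j) ⟨
      x ⊕ weighted (forward e j)      ∎)
    where open ≡-Reasoning
  ... | e , e≤ , z≡y | j , inj₂ x≡y⊕r =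
    backward e j ,
    (λ i → m≤2ℓ+c⇒m+n≤2[1+ℓ]+c {ℓ = ℓ} {c = c} (e≤ i) (m≤n⇒m≤1+n (m∸n≤m 1 (δ j i)))) , (begin
      z ⊕ (suc ℓ + c) * Σr             ≡⟨ ⊕-+-comm z Σr ((ℓ + c) * Σr) ⟩
      z ⊕ (ℓ + c) * Σr ⊕ Σr            ≡⟨ trans (cong (_⊕ Σr) z≡y) (⊕-assoc y (weighted e) Σr) ⟩
      y ⊕ (weighted e + Σr)            ≡⟨ cong (y ⊕_) (weighted-backward e j) ⟨
      y ⊕ (weighted e′ + r j)          ≡⟨ ⊕-+-comm y (weighted e′) (r j) ⟩
      y ⊕ r j ⊕ weighted e′            ≡⟨ cong (_⊕ weighted e′) x≡y⊕r ⟨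
      x ⊕ weighted e′                  ∎)
    where
    open ≡-Reasoning
    e′ = backward e j

  within-displacement : ∀ {d x z} → Within d x z →
                        ∃[ e ] ((∀ i → e i ≤ 2 * d) × z ⊕ d * Σr ≡ x ⊕ weighted e)
  within-displacement {d} {x} {z} (ℓ , ℓ≤d , w) with displacement (d ∸ ℓ) w
  ... | e , e≤ , eq = e , (λ i → ≤-trans (e≤ i) 2ℓ+[d∸ℓ]≤2d) ,
                      subst (λ t → z ⊕ t * Σr ≡ x ⊕ weighted e) (m+[n∸m]≡n ℓ≤d) eq
    where
    2ℓ+[d∸ℓ]≤2d : 2 * ℓ + (d ∸ ℓ) ≤ 2 * d
    2ℓ+[d∸ℓ]≤2d = begin
      2 * ℓ + (d ∸ ℓ)       ≡⟨ cong (λ t → ℓ + t + (d ∸ ℓ)) (+-identityʳ ℓ) ⟩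
      ℓ + ℓ + (d ∸ ℓ)       ≡⟨ +-assoc ℓ ℓ (d ∸ ℓ) ⟩
      ℓ + (ℓ + (d ∸ ℓ))     ≡⟨ cong (ℓ +_) (m+[n∸m]≡n ℓ≤d) ⟩
      ℓ + d                 ≤⟨ +-monoˡ-≤ d ℓ≤d ⟩
      d + d                 ≡⟨ cong (d +_) (+-identityʳ d) ⟨
      2 * d                 ∎
      where open ≤-Reasoning

  -- The endpoint y is determined by its coefficient vector, which ranges over [0, 2d]^m.
  ball-size : ∀ d x → (∀ y → Within d x y) → n ≤ suc (2 * d) ^ m
  ball-size d x within = injective⇒≤ code-injective
    where
    coefficients : Fin n → Fin m → ℕ
    coefficients y = proj₁ (within-displacement (within y))
    code : Fin n → Fin (suc (2 * d) ^ m)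
    code y = funToFin (λ i → fromℕ< (s≤s (proj₁ (proj₂ (within-displacement (within y))) i)))
    code-injective : ∀ {y y′} → code y ≡ code y′ → y ≡ y′
    code-injective {y} {y′} eq = ⊕-cancelʳ (d * Σr) (begin
      y ⊕ d * Σr                      ≡⟨ proj₂ (proj₂ (within-displacement (within y))) ⟩
      x ⊕ weighted (coefficients y)   ≡⟨ cong (x ⊕_) (weighted-cong same) ⟩
      x ⊕ weighted (coefficients y′)  ≡⟨ proj₂ (proj₂ (within-displacement (within y′))) ⟨
      y′ ⊕ d * Σr                     ∎)
      where
      open ≡-Reasoning
      same : ∀ i → coefficients y i ≡ coefficients y′ i
      same i = trans (sym (toℕ-fromℕ< _)) (trans (cong toℕ (funToFin-injective eq i)) (toℕ-fromℕ< _))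

module MixedRadix (m n : ℕ) {{_ : NonZero m}} {{_ : NonZero n}} (r : Fin m → ℕ)
                  (R : ℕ → ℕ) (C : ℕ)
                  (R₀≡1 : R 0 ≡ 1)
                  (R[m]≡n : R m ≡ n)
                  (R-pos : ∀ {k} → k < m → 0 < R k)
                  (R-ratio : ∀ {k} → k < m → R (suc k) ^ m ≤ C * R k ^ m)
                  (R-edge : ∀ {k} → k < m → ∀ x → Λ.Adj m n r x (Translation._⊕_ n x (R k))) where

  open Λ m n r
  open Translation n
  open Walks m n r using (_++ʷ_; walk-⊕-*)

  digit-bound : ∀ {k z q} → k < m → z < R (suc k) → q * R k ≤ z → q ^ m ≤ C
  digit-bound {k} {z} {q} k<m z<R qR≤z = <⇒≤ (*-cancelʳ-< (R k ^ m) (q ^ m) C (begin-strict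
    q ^ m * R k ^ m   ≡⟨ ^-distribʳ-* q (R k) m ⟨
    (q * R k) ^ m     ≤⟨ ^-monoˡ-≤ m qR≤z ⟩
    z ^ m             <⟨ ^-monoˡ-< m z<R ⟩
    R (suc k) ^ m     ≤⟨ R-ratio k<m ⟩
    C * R k ^ m       ∎))
    where open ≤-Reasoning

  -- z is reached by q = z / R k steps of length R k followed by a walk to the remainder;
  -- K bounds all digits used
  digit-walk : ∀ k → k ≤ m → ∀ {z} → z < R k → ∀ x →
               ∃[ ℓ ] ∃[ K ] (Walk x (x ⊕ z) ℓ × ℓ ≤ k * K × K ^ m ≤ C)
  digit-walk zero    _   {zero}  _     x =
    0 , 0 , subst (λ y → Walk x y 0) (sym (⊕-identityʳ x)) here , z≤n , subst (_≤ C) (sym (0^k≡0 m)) z≤n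
  digit-walk zero    _   {suc z} z<R₀  x = contradiction (subst (suc z <_) R₀≡1 z<R₀) λ { (s≤s ()) }
  digit-walk (suc k) k<m {z}     z<R   x = extend (digit-walk k (<⇒≤ k<m) (m%n<n z (R k)) x′)
    where
    instance
      R-nonZero : NonZero (R k)
      R-nonZero = >-nonZero (R-pos k<m)
    q = z / R k
    x′ = x ⊕ q * R k
    arrive : x′ ⊕ z % R k ≡ x ⊕ z
    arrive = trans (⊕-assoc x (q * R k) (z % R k))
                   (cong (x ⊕_) (trans (+-comm (q * R k) (z % R k)) (sym (m≡m%n+[m/n]*n z (R k)))))
    extend : ∃[ ℓ ] ∃[ K ] (Walk x′ (x′ ⊕ z % R k) ℓ × ℓ ≤ k * K × K ^ m ≤ C) →
             ∃[ ℓ ] ∃[ K ] (Walk x (x ⊕ z) ℓ × ℓ ≤ suc k * K × K ^ m ≤ C)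
    extend (ℓ , K , w , ℓ≤kK , K^m≤C) =
      q + ℓ , q ⊔ K ,
      walk-⊕-* (R k) (R-edge k<m) q x ++ʷ subst (λ y → Walk x′ y ℓ) arrive w ,
      +-mono-≤ (m≤m⊔n q K) (≤-trans ℓ≤kK (*-monoʳ-≤ k (m≤n⊔m q K))) ,
      ⊔-^-≤ m (digit-bound k<m z<R (m/n*n≤m z (R k))) K^m≤C

  distance-bound : ∀ x y → ∃[ ℓ ] (Walk x y ℓ × ℓ ^ m ≤ m ^ m * C)
  distance-bound x y with digit-walk m ≤-refl (subst (diff x y <_) (sym R[m]≡n) (diff<n x y)) x
  ... | ℓ , K , w , ℓ≤mK , K^m≤C = ℓ , subst (λ y → Walk x y ℓ) (⊕-diff x y) w , (begin
    ℓ ^ m           ≤⟨ ^-monoˡ-≤ m ℓ≤mK ⟩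
    (m * K) ^ m     ≡⟨ ^-distribʳ-* m K m ⟩
    m ^ m * K ^ m   ≤⟨ *-monoʳ-≤ (m ^ m) K^m≤C ⟩
    m ^ m * C       ∎)
    where open ≤-Reasoning

module NearestInteger (m n : ℕ) {{_ : NonZero n}} where

  private
    2^m*n^j>0 : ∀ j → 0 < 2 ^ m * n ^ j
    2^m*n^j>0 j = *-mono-≤ (m^n>0 2 m) (m^n>0 n j)

  nearest-pos : ∀ j r → IsNearest m n j r → 0 < r
  nearest-pos j zero    (_ , upper) = contradiction (subst (2 ^ m * n ^ j <_) (^-zeroˡ m) upper)
                                                      (≤⇒≯ (2^m*n^j>0 j))
  nearest-pos j (suc r) _           = z<s

  nearest-lower : ∀ j r → IsNearest m n j r → r ^ m ≤ 2 ^ m * n ^ j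
  nearest-lower j r near@(lower , _) = ≤-trans (^-monoˡ-≤ m (r≤2r∸1 r (nearest-pos j r near))) lower

  nearest-upper : ∀ j r → IsNearest m n j r → 2 ^ m * n ^ j < (3 * r) ^ m
  nearest-upper j r near@(_ , upper) = <-≤-trans upper (^-monoˡ-≤ m (2r+1≤3r r (nearest-pos j r near)))

  nearest-zero : .{{_ : NonZero m}} → ∀ r → IsNearest m n 0 r → r ≡ 1
  nearest-zero zero          near        = contradiction (nearest-pos 0 0 near) λ ()
  nearest-zero (suc zero)    _           = refl
  nearest-zero (suc (suc t)) (lower , _) = contradiction lower (<⇒≱ (begin-strict
    2 ^ m * 1                  ≡⟨ *-identityʳ (2 ^ m) ⟩
    2 ^ m                      <⟨ ^-monoˡ-< m 2<2r∸1 ⟩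
    (2 * suc (suc t) ∸ 1) ^ m  ∎))
    where
    open ≤-Reasoning
    2<2r∸1 : 2 < 2 * suc (suc t) ∸ 1
    2<2r∸1 = s≤s (≤-trans (s≤s (s≤s z≤n)) (m≤n+m (suc (suc (t + 0))) t))

  nearest-ratio : ∀ k r r′ → IsNearest m n k r →
                  r′ ^ m ≤ 2 ^ m * n ^ suc k → r′ ^ m ≤ 3 ^ m * n * r ^ m
  nearest-ratio k r r′ near r′-lower = begin
    r′ ^ m                ≤⟨ r′-lower ⟩
    2 ^ m * (n * n ^ k)   ≡⟨ x[yz]≡y[xz] (2 ^ m) n (n ^ k) ⟩
    n * (2 ^ m * n ^ k)   ≤⟨ *-monoʳ-≤ n (<⇒≤ (nearest-upper k r near)) ⟩
    n * (3 * r) ^ m       ≡⟨ cong (n *_) (^-distribʳ-* 3 r m) ⟩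
    n * (3 ^ m * r ^ m)   ≡⟨ x[yz]≡[yx]z n (3 ^ m) (r ^ m) ⟩
    3 ^ m * n * r ^ m     ∎
    where
    open ≤-Reasoning
    x[yz]≡y[xz] : ∀ x y z → x * (y * z) ≡ y * (x * z)
    x[yz]≡y[xz] = solve-∀
    x[yz]≡[yx]z : ∀ x y z → x * (y * z) ≡ y * x * z
    x[yz]≡[yx]z = solve-∀

  nearest-increasing : 3 ^ m < n → ∀ {i j} r r′ → i < j →
                       IsNearest m n i r → IsNearest m n j r′ → r < r′
  nearest-increasing 3^m<n {i} {j} r r′ i<j near near′ = ≰⇒> λ r′≤r →
    <-asym 3^m<n (*-cancelˡ-< X n (3 ^ m) (begin-strict
      X * n                   ≡⟨ trans (*-assoc (2 ^ m) (n ^ i) n) (cong (2 ^ m *_) (*-comm (n ^ i) n)) ⟩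
      2 ^ m * n ^ suc i       ≤⟨ *-monoʳ-≤ (2 ^ m) (^-monoʳ-≤ n i<j) ⟩
      2 ^ m * n ^ j           <⟨ nearest-upper j r′ near′ ⟩
      (3 * r′) ^ m            ≤⟨ ^-monoˡ-≤ m (*-monoʳ-≤ 3 r′≤r) ⟩
      (3 * r) ^ m             ≡⟨ ^-distribʳ-* 3 r m ⟩
      3 ^ m * r ^ m           ≤⟨ *-monoʳ-≤ (3 ^ m) (nearest-lower i r near) ⟩
      3 ^ m * X               ≡⟨ *-comm (3 ^ m) X ⟩
      X * 3 ^ m               ∎))
    where
    open ≤-Reasoning
    X = 2 ^ m * n ^ i

  nearest-small : 4 ^ m < n → ∀ {j} r → j < m → IsNearest m n j r → 2 * r < n
  nearest-small 4^m<n {j} r j<m near = ≰⇒> λ n≤2r →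
    <⇒≱ 4^m<n (*-cancelˡ-≤ (n ^ j) {{m^n≢0 n j}} (begin
      n ^ j * n                 ≡⟨ *-comm (n ^ j) n ⟩
      n ^ suc j                 ≤⟨ ^-monoʳ-≤ n j<m ⟩
      n ^ m                     ≤⟨ ^-monoˡ-≤ m n≤2r ⟩
      (2 * r) ^ m               ≡⟨ ^-distribʳ-* 2 r m ⟩
      2 ^ m * r ^ m             ≤⟨ *-monoʳ-≤ (2 ^ m) (nearest-lower j r near) ⟩
      2 ^ m * (2 ^ m * n ^ j)   ≡⟨ x[xy]≡y[xx] (2 ^ m) (n ^ j) ⟩
      n ^ j * (2 ^ m * 2 ^ m)   ≡⟨ cong (n ^ j *_) (^-distribʳ-* 2 2 m) ⟨
      n ^ j * 4 ^ m             ∎))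
    where
    open ≤-Reasoning
    x[xy]≡y[xx] : ∀ x y → x * (x * y) ≡ y * (x * x)
    x[xy]≡y[xx] = solve-∀

module NearestCayleyGraph (m n : ℕ) {{_ : NonZero m}} {{_ : NonZero n}} (4^m<n : 4 ^ m < n)
                          (r : Fin m → ℕ) (near : ∀ j → IsNearest m n (toℕ j) (r j)) where

  open Λ m n r
  open Translation n
  open NearestInteger m n
  open CayleyGraph m n r using (Adj-⊕; vertexTransitive) public
  open Walks m n r using (Connected; diameter-exists)
  open Ball m n r using (ball-size)

  3^m<n : 3 ^ m < n
  3^m<n = ≤-<-trans (^-monoˡ-≤ m (n≤1+n 3)) 4^m<n

  r-pos : ∀ j → 0 < r j
  r-pos j = nearest-pos (toℕ j) (r j) (near j)

  r+r<n : ∀ i j → r i + r j < n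
  r+r<n i j = +-<-halves (r i) (r j) (2r<n i) (2r<n j)
    where
    2r<n : ∀ j → 2 * r j < n
    2r<n j = nearest-small 4^m<n (r j) (toℕ<n j) (near j)

  r-increasing : ∀ {i j} → toℕ i < toℕ j → r i < r j
  r-increasing {i} {j} i<j = nearest-increasing 3^m<n (r i) (r j) i<j (near i) (near j)

  r-injective : ∀ {i j} → r i ≡ r j → i ≡ j
  r-injective {i} {j} ri≡rj with <-cmp (toℕ i) (toℕ j)
  ... | tri< i<j _ _ = contradiction ri≡rj (<⇒≢ (r-increasing i<j))
  ... | tri≈ _ i≡j _ = toℕ-injective i≡j
  ... | tri> _ _ j<i = contradiction (sym ri≡rj) (<⇒≢ (r-increasing j<i))

  open Separated m n r r-pos r+r<n r-injective using (regular) public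

  -- r_0, …, r_{m-1}, extended by r_m = n
  R : ℕ → ℕ
  R = ladder r n

  near-R : ∀ {k} → k < m → IsNearest m n k (R k)
  near-R k<m = subst₂ (IsNearest m n) (toℕ-fromℕ< k<m) (sym (ladder-< r n k<m)) (near (fromℕ< k<m))

  R-lower : ∀ {k} → k ≤ m → R k ^ m ≤ 2 ^ m * n ^ k
  R-lower {k} k≤m with m≤n⇒m<n∨m≡n k≤m
  ... | inj₁ k<m  = nearest-lower k (R k) (near-R k<m)
  ... | inj₂ refl = subst (λ t → t ^ m ≤ 2 ^ m * n ^ m) (sym (ladder-top r n))
                          (m≤n*m (n ^ m) (2 ^ m) {{m^n≢0 2 m}})

  R-ratio : ∀ {k} → k < m → R (suc k) ^ m ≤ 3 ^ m * n * R k ^ m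
  R-ratio {k} k<m = nearest-ratio k (R k) (R (suc k)) (near-R k<m) (R-lower k<m)

  R-edge : ∀ {k} → k < m → ∀ x → Adj x (x ⊕ R k)
  R-edge k<m x = subst (λ t → Adj x (x ⊕ t)) (sym (ladder-< r n k<m)) (Adj-⊕ (fromℕ< k<m) x)

  open MixedRadix m n r R (3 ^ m * n) (nearest-zero (R 0) (near-R (>-nonZero⁻¹ m))) (ladder-top r n)
                  (λ {k} k<m → nearest-pos k (R k) (near-R k<m)) R-ratio R-edge

  connected : Connected (m ^ m * (3 ^ m * n))
  connected x y with distance-bound x y
  ... | ℓ , w , ℓ^m≤ = ℓ , ≤-trans (a≤a^k ℓ m) ℓ^m≤ , w

  diameter-upper : ∀ {d} → HasDiameter d → d ^ m ≤ m ^ m * 3 ^ m * n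
  diameter-upper (_ , x , y , far) with distance-bound x y
  ... | ℓ , w , ℓ^m≤ = ≤-trans (^-monoˡ-≤ m (far ℓ w))
                               (subst (ℓ ^ m ≤_) (sym (*-assoc (m ^ m) (3 ^ m) n)) ℓ^m≤)

  diameter-lower : ∀ {d} → HasDiameter d → n ≤ 3 ^ m * d ^ m
  diameter-lower {d} (conn , _) = widen d (ball-size d x₀ (conn x₀))
    where
    x₀ = fromℕ< (>-nonZero⁻¹ n)
    widen : ∀ k → n ≤ suc (2 * k) ^ m → n ≤ 3 ^ m * k ^ m
    widen zero    n≤1 = contradiction (≤-trans n≤1 (≤-reflexive (^-zeroˡ m)))
                                      (<⇒≱ (≤-<-trans (m^n>0 4 m) 4^m<n))
    widen k@(suc _) n≤  = ≤-trans n≤ (begin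
      suc (2 * k) ^ m   ≤⟨ ^-monoˡ-≤ m (subst (_≤ 3 * k) (+-comm (2 * k) 1) (2r+1≤3r k z<s)) ⟩
      (3 * k) ^ m       ≡⟨ ^-distribʳ-* 3 k m ⟩
      3 ^ m * k ^ m     ∎)
      where open ≤-Reasoning

  diameter : ∃[ d ] HasDiameter d
  diameter = diameter-exists connected

theorem4 : ∀ (m : ℕ) → 3 ≤ m →
  ∃[ A ] ∃[ B ] ∃[ N ] (∀ (n : ℕ) {{_ : NonZero n}} → N ≤ n →
    (r : Fin m → ℕ) → (∀ (j : Fin m) → IsNearest m n (toℕ j) (r j)) →
      Λ.Regular2m m n r × Λ.VertexTransitive m n r
      × ∃[ d ] (Λ.HasDiameter m n r d × (n ≤ A * d ^ m) × (d ^ m ≤ B * n)))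
theorem4 m@(suc _) _ = 3 ^ m , m ^ m * 3 ^ m , suc (4 ^ m) , λ n 4^m<n r near →
  let open NearestCayleyGraph m n 4^m<n r near
      d , diameter-d = diameter
  in regular , vertexTransitive , d , diameter-d , diameter-lower diameter-d , diameter-upper diameter-d
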